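{- Let $b\ge3$ be odd, let $a=a(b,i)$ be the $i$-th input of the complete MDS system, and let $MDS(b,i)=(c_1,\dots,c_P)$ be the primitive period of $c_j=\mathrm{mod}^*(a2^j,b)$, $j\ge1$ (so $c_P=a$). - Let $co_1,\dots,co_{r^*}$ be the odd entries of $MDS(b,i)$ in order, and let $\mathrm{ind}(co_j)$ be the position of $co_j$ in $MDS(b,i)$. - Define $U(b,i)=(u_1,\dots,u_{r^*})$ by $u_j=co_{r^*-j+1}$; these are the odd entries read backwards. - Define $L(b,i)=(l_1,\dots,l_{r^*})$ by $l_j=\mathrm{ind}(u_j)-\mathrm{ind}(u_{j+1})$, with $\mathrm{ind}(u_{r^*+1}):=0$. Let $\Sigma(b,i)=[A(b,i),K(b,i)]$ be the Hilton–Pedersen coach with input $a_1=a$. Then $U(b,i)=A(b,i)$ and $L(b,i)=K(b,i)$; in particular both rows have length $r^*$.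
   Context: For odd $b\ge3$: - $RRS^*(b)=\{r\in\mathbb Z:1\le r\le(b-1)/2,\ \gcd(r,b)=1\}$. - For $m$ coprime to $b$, $\mathrm{mod}^*(m,b)=\mathrm{mod}(m,b)$ if the least non-negative residue $\mathrm{mod}(m,b)$ is $\le b/2$, and $\mathrm{mod}^*(m,b)=\mathrm{mod}(-m,b)$ otherwise. - MDS inputs: $a(b,1)=1$, and $a(b,i+1)$ is the smallest odd element of $RRS^*(b)$ not occurring in the sequences with earlier inputs. - Coach with odd input $a_1$, $1\le a_1<b/2$, $\gcd(a_1,b)=1$: $a_{j+1}=(b-a_j)/2^{k_j}$, where $k_j$ is the $2$-adic valuation of $b-a_j$. With $r$ the least $r\ge1$ such that $a_{r+1}=a_1$, the upper row is $A=(a_1,\dots,a_r)$ and the lower row is $K=(k_1,\dots,k_r)$. -}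

module Defs where

open import Data.Nat.Base
open import Data.Nat.DivMod using (_%_; _/_)
open import Data.Nat.Properties using (_≟_)
open import Data.Nat.Coprimality using (Coprime)
open import Data.Bool.Base using (Bool; true; false; if_then_else_)
open import Data.List.Base using (List; []; _∷_; map; filter; upTo; reverse; zipWith; _++_)
open import Data.List.Membership.Propositional using (_∈_)
open import Data.Product using (_×_)
open import Relation.Binary.PropositionalEquality using (_≡_; _≢_)
open import Relation.Nullary using (¬_; yes; no)

IsOdd : ℕ → Set
IsOdd x = x % 2 ≡ 1

-- r ∈ RRS*(b):  1 ≤ r ≤ (b-1)/2  (equivalently 2r < b for odd b) and gcd(r,b) = 1
InRRS* : ℕ → ℕ → Set
InRRS* b r = 1 ≤ r × 2 * r < b × Coprime r b

-- mod*(m,b): least nonneg residue if it is ≤ b/2, otherwise mod(-m,b) = b - mod(m,b)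
-- (for m coprime to b the residue is nonzero, so mod(-m,b) = b - mod(m,b)).
modStar : ℕ → (b : ℕ) → .{{NonZero b}} → ℕ
modStar m b = if 2 * (m % b) ≤ᵇ b then m % b else b ∸ (m % b)

mdsSeq : (b : ℕ) → .{{NonZero b}} → ℕ → ℕ → ℕ
mdsSeq b a j = modStar (a * 2 ^ j) b

NotCovered : (b : ℕ) → .{{NonZero b}} → List ℕ → ℕ → Set
NotCovered b xs y = ∀ x → x ∈ xs → ∀ j → 1 ≤ j → mdsSeq b x j ≢ y

SmallestNew : (b : ℕ) → .{{NonZero b}} → List ℕ → ℕ → Set
SmallestNew b xs x =
  IsOdd x × InRRS* b x × NotCovered b xs x ×
  (∀ y → IsOdd y → InRRS* b y → NotCovered b xs y → x ≤ y)

-- MDSInputs b (a(b,i) ∷ a(b,i-1) ∷ … ∷ a(b,1) ∷ []):  the list of the first i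
-- MDS inputs, latest first.
data MDSInputs (b : ℕ) .{{_ : NonZero b}} : List ℕ → Set where
  first : MDSInputs b (1 ∷ [])
  next  : ∀ {xs x} → MDSInputs b xs → SmallestNew b xs x → MDSInputs b (x ∷ xs)

IsPrimitivePeriod : (ℕ → ℕ) → ℕ → Set
IsPrimitivePeriod c P =
  1 ≤ P × (∀ j → 1 ≤ j → c (j + P) ≡ c j) ×
  (∀ Q → 1 ≤ Q → Q < P → ¬ (∀ j → 1 ≤ j → c (j + Q) ≡ c j))

positions : ℕ → List ℕ
positions P = map suc (upTo P)

oddPositions : (ℕ → ℕ) → ℕ → List ℕ
oddPositions c P = filter (λ j → c j % 2 ≟ 1) (positions P)

Urow : (ℕ → ℕ) → ℕ → List ℕ
Urow c P = reverse (map c (oddPositions c P))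

diffs : List ℕ → List ℕ
diffs [] = []
diffs (x ∷ xs) = zipWith _∸_ (x ∷ xs) (xs ++ (0 ∷ []))

Lrow : (ℕ → ℕ) → ℕ → List ℕ
Lrow c P = diffs (reverse (oddPositions c P))

-- 2-adic valuation (fuel n suffices since n has fewer than n factors 2 for n ≥ 1;
-- val2 0 = 0 by convention, never used for the coach since b - a_j > 0 there)
val2Fuel : ℕ → ℕ → ℕ
val2Fuel zero n = 0
val2Fuel (suc f) zero = 0
val2Fuel (suc f) (suc m) with (suc m) % 2 ≟ 0
... | yes _ = suc (val2Fuel f ((suc m) / 2))
... | no _ = 0

val2 : ℕ → ℕ
val2 n = val2Fuel n n

oddPartFuel : ℕ → ℕ → ℕ
oddPartFuel zero n = n
oddPartFuel (suc f) zero = 0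
oddPartFuel (suc f) (suc m) with (suc m) % 2 ≟ 0
... | yes _ = oddPartFuel f ((suc m) / 2)
... | no _ = suc m

oddPart : ℕ → ℕ
oddPart n = oddPartFuel n n

-- coach sequence (0-indexed): coachA b a j = a_{j+1},  coachK b a j = k_{j+1}
coachK : ℕ → ℕ → ℕ → ℕ
coachA : ℕ → ℕ → ℕ → ℕ
coachK b a j = val2 (b ∸ coachA b a j)
coachA b a zero = a
coachA b a (suc j) = oddPart (b ∸ coachA b a j)

IsCoachLength : ℕ → ℕ → ℕ → Set
IsCoachLength b a r =
  1 ≤ r × coachA b a r ≡ a × (∀ s → 1 ≤ s → s < r → coachA b a s ≢ a)

Arow : ℕ → ℕ → ℕ → List ℕ
Arow b a r = map (coachA b a) (upTo r)

Krow : ℕ → ℕ → ℕ → List ℕ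
Krow b a r = map (coachK b a) (upTo r)

{-# OPTIONS --safe #-}
-- Reading MDS(b,i) backwards is running the coach.  With fold r = mod*(r,b) one has
-- c_{j+1} = fold (2 c_j), and u ↦ fold (2u) is injective on 0 ≤ u < b/2 because b is
-- odd.  So if c_j = x is odd and b − x = 2^k y with y odd, then fold (2 · 2^{k−1} y) = x
-- forces c_{j−1} = 2^{k−1} y, then c_{j−2} = 2^{k−2} y, …, c_{j−k} = y: the k − 1
-- entries strictly between are even, and the walk cannot pass position 0 because
-- c_0 = a is odd.  Starting from c_P = a and iterating, the odd positions of the period,
-- read from the top, are P = p_0 > p_1 > … > p_r = 0 with c_{p_t} = a_{t+1} and
-- p_t − p_{t+1} = k_{t+1}; primitivity of P makes r the length of the coach.
module Submission where

open import Defs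
open import Data.Nat.Base
open import Data.Nat.Properties
open import Data.Nat.DivMod
open import Data.Bool.Base using (true; false; if_then_else_)
open import Data.Product using (Σ; _×_; _,_; proj₁; proj₂)
open import Data.Sum using (_⊎_; inj₁; inj₂; [_,_]′)
open import Data.List.Base using (List; []; _∷_; _∷ʳ_; _++_; applyUpTo; applyDownFrom; filter; map; reverse; upTo)
open import Data.List.Properties using (filter-accept; filter-reject; filter-++; unfold-reverse; ++-identityʳ; reverse-map; map-upTo; map-applyUpTo; reverse-applyUpTo)
open import Relation.Binary.PropositionalEquality
open import Relation.Nullary using (¬_; yes; no; contradiction)
open import Relation.Unary using (Pred; Decidable)
open import Level using (0ℓ)
open import Function.Base using (id; _∘′_)

¬odd-double : ∀ q → ¬ IsOdd (2 * q)
¬odd-double q odd with trans (sym odd) (trans (cong (_% 2) (*-comm 2 q)) (m*n%n≡0 q 2))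
... | ()

odd⇒>0 : ∀ {x} → IsOdd x → 0 < x
odd⇒>0 {suc x} _ = z<s

even-or-odd : ∀ n → n % 2 ≡ 0 ⊎ IsOdd n
even-or-odd n with n % 2 | m%n<n n 2
... | zero | _ = inj₁ refl
... | suc zero | _ = inj₂ refl
... | suc (suc _) | s≤s (s≤s ())

odd∸odd-even : ∀ {m n} → IsOdd m → IsOdd n → n ≤ m → (m ∸ n) % 2 ≡ 0
odd∸odd-even {m} {n} m-odd n-odd n≤m with even-or-odd (m ∸ n)
... | inj₁ even = even
... | inj₂ odd = contradiction (trans (sym m-even) m-odd) 0≢1+n
  where
    m-even : m % 2 ≡ 0
    m-even = begin
      m % 2                     ≡⟨ cong (_% 2) (sym (m+[n∸m]≡n n≤m)) ⟩
      (n + (m ∸ n)) % 2         ≡⟨ %-distribˡ-+ n (m ∸ n) 2 ⟩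
      (n % 2 + (m ∸ n) % 2) % 2 ≡⟨ cong₂ (λ u v → (u + v) % 2) n-odd odd ⟩
      0                         ∎
      where open ≡-Reasoning

oddPartFuel-spec : ∀ f n → 0 < n → n ≤ f →
  2 ^ val2Fuel f n * oddPartFuel f n ≡ n × IsOdd (oddPartFuel f n)
oddPartFuel-spec (suc f) (suc m) _ m<f with suc m % 2 ≟ 0
... | no ¬even = +-identityʳ (suc m) , [ (λ even → contradiction even ¬even) , id ]′ (even-or-odd (suc m))
... | yes even =
  trans (*-assoc 2 (2 ^ val2Fuel f h) (oddPartFuel f h)) (trans (cong (2 *_) (proj₁ ih)) (sym m≡2h)) , proj₂ ih
  where
    h : ℕ
    h = suc m / 2
    m≡2h : suc m ≡ 2 * h
    m≡2h = trans (m≡m%n+[m/n]*n (suc m) 2) (trans (cong (_+ h * 2) even) (*-comm h 2))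
    h>0 : 0 < h
    h>0 = n≢0⇒n>0 (λ h≡0 → 0≢1+n (sym (trans m≡2h (cong (2 *_) h≡0))))
    h<m : h < suc m
    h<m = subst (h <_) (sym m≡2h) (m<m+n h (≤-trans h>0 (m≤m+n h 0)))
    ih : 2 ^ val2Fuel f h * oddPartFuel f h ≡ h × IsOdd (oddPartFuel f h)
    ih = oddPartFuel-spec f h h>0 (≤-pred (≤-trans h<m m<f))

oddPart-spec : ∀ n → 0 < n → 2 ^ val2 n * oddPart n ≡ n × IsOdd (oddPart n)
oddPart-spec n n>0 = oddPartFuel-spec n n n>0 ≤-refl

val2-pos : ∀ n → 0 < n → n % 2 ≡ 0 → 0 < val2 n
val2-pos (suc m) _ even with suc m % 2 ≟ 0
... | yes _ = z<s
... | no ¬even = contradiction even ¬even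

-- modStar m b is definitionally fold b (m % b).
fold : ℕ → ℕ → ℕ
fold b r = if 2 * r ≤ᵇ b then r else b ∸ r

fold-≤ : ∀ {b} r → 2 * r ≤ b → fold b r ≡ r
fold-≤ {b} r p with 2 * r ≤ᵇ b | ≤⇒≤ᵇ p
... | true | _ = refl

fold-> : ∀ {b} r → b < 2 * r → fold b r ≡ b ∸ r
fold-> {b} r p with 2 * r ≤ᵇ b | ≤ᵇ⇒≤ (2 * r) b
... | true | le = contradiction (le _) (<⇒≱ p)
... | false | _ = refl

double-complement : ∀ {b s} → s ≤ b → 2 * s + 2 * (b ∸ s) ≡ b + b
double-complement {b} {s} s≤b = begin
  2 * s + 2 * (b ∸ s) ≡⟨ sym (*-distribˡ-+ 2 s (b ∸ s)) ⟩
  2 * (s + (b ∸ s))   ≡⟨ cong (2 *_) (m+[n∸m]≡n s≤b) ⟩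
  b + (b + 0)         ≡⟨ cong (b +_) (+-identityʳ b) ⟩
  b + b               ∎
  where open ≡-Reasoning

complement-< : ∀ {b s} → s ≤ b → 2 * s < b → b < 2 * (b ∸ s)
complement-< {b} {s} s≤b p = +-cancelˡ-< b b (2 * (b ∸ s))
  (subst (_< b + 2 * (b ∸ s)) (double-complement s≤b) (+-monoˡ-< (2 * (b ∸ s)) p))

complement-> : ∀ {b s} → s ≤ b → b < 2 * s → 2 * (b ∸ s) < b
complement-> {b} {s} s≤b p = +-cancelˡ-< b (2 * (b ∸ s)) b
  (subst (b + 2 * (b ∸ s) <_) (double-complement s≤b) (+-monoˡ-< (2 * (b ∸ s)) p))

half⇒< : ∀ {b} x → 2 * x < b → x < b
half⇒< x = ≤-<-trans (m≤m+n x (x + 0))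

module Fold (b : ℕ) .{{_ : NonZero b}} (b-odd : IsOdd b) where

  double-≤⇒< : ∀ r → 2 * r ≤ b → 2 * r < b
  double-≤⇒< r p with m≤n⇒m<n∨m≡n p
  ... | inj₁ lt = lt
  ... | inj₂ eq = contradiction (subst IsOdd (sym eq) b-odd) (¬odd-double r)

  fold-∸ : ∀ {s} → s ≤ b → fold b (b ∸ s) ≡ fold b s
  fold-∸ {s} s≤b with 2 * s ≤? b
  ... | yes p =
    trans (fold-> (b ∸ s) (complement-< s≤b (double-≤⇒< s p))) (trans (m∸[m∸n]≡n s≤b) (sym (fold-≤ s p)))
  ... | no p = trans (fold-≤ (b ∸ s) (<⇒≤ (complement-> s≤b (≰⇒> p)))) (sym (fold-> s (≰⇒> p)))

  fold-half : ∀ {s} → s ≤ b → 2 * fold b s < b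
  fold-half {s} s≤b with 2 * s ≤? b
  ... | yes p = subst (λ z → 2 * z < b) (sym (fold-≤ s p)) (double-≤⇒< s p)
  ... | no p = subst (λ z → 2 * z < b) (sym (fold-> s (≰⇒> p))) (complement-> s≤b (≰⇒> p))

  private
    fold-double-mixed : ∀ u v → 2 * (2 * u) ≤ b → b < 2 * (2 * v) → 2 * v < b →
      fold b (2 * u) ≢ fold b (2 * v)
    fold-double-mixed u v p q v-half eq = ¬odd-double (u + v) (subst IsOdd b≡ b-odd)
      where
        open ≡-Reasoning
        2u≡b∸2v : 2 * u ≡ b ∸ 2 * v
        2u≡b∸2v = trans (sym (fold-≤ (2 * u) p)) (trans eq (fold-> (2 * v) q))
        b≡ : b ≡ 2 * (u + v)
        b≡ = begin
          b                   ≡⟨ sym (m∸n+n≡m (<⇒≤ v-half)) ⟩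
          (b ∸ 2 * v) + 2 * v ≡⟨ cong (_+ 2 * v) (sym 2u≡b∸2v) ⟩
          2 * u + 2 * v       ≡⟨ sym (*-distribˡ-+ 2 u v) ⟩
          2 * (u + v)         ∎

  fold-double-injective : ∀ u v → 2 * u < b → 2 * v < b → fold b (2 * u) ≡ fold b (2 * v) → u ≡ v
  fold-double-injective u v u-half v-half eq with 2 * (2 * u) ≤? b | 2 * (2 * v) ≤? b
  ... | yes p | yes q = *-cancelˡ-≡ u v 2 (trans (sym (fold-≤ (2 * u) p)) (trans eq (fold-≤ (2 * v) q)))
  ... | no p | no q = *-cancelˡ-≡ u v 2 (∸-cancelˡ-≡ (<⇒≤ u-half) (<⇒≤ v-half)
                        (trans (sym (fold-> (2 * u) (≰⇒> p))) (trans eq (fold-> (2 * v) (≰⇒> q)))))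
  ... | yes p | no q = contradiction eq (fold-double-mixed u v p (≰⇒> q) v-half)
  ... | no p | yes q = contradiction (sym eq) (fold-double-mixed v u q (≰⇒> p) u-half)

  %-double : ∀ m → (2 * m) % b ≡ (2 * (m % b)) % b
  %-double m = begin
    (2 * m) % b                 ≡⟨ %-distribˡ-* 2 m b ⟩
    (2 % b * (m % b)) % b       ≡⟨ cong (λ z → (2 % b * z) % b) (sym (m%n%n≡m%n m b)) ⟩
    (2 % b * (m % b % b)) % b   ≡⟨ sym (%-distribˡ-* 2 (m % b) b) ⟩
    (2 * (m % b)) % b           ∎
    where open ≡-Reasoning

  fold-double-residue : ∀ {r} → r < b → fold b ((2 * r) % b) ≡ fold b (2 * fold b r)
  fold-double-residue {r} r<b with 2 * r ≤? b
  ... | yes p =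
    trans (cong (fold b) (m<n⇒m%n≡m (double-≤⇒< r p))) (cong (λ z → fold b (2 * z)) (sym (fold-≤ r p)))
  ... | no p = begin
    fold b ((2 * r) % b)     ≡⟨ cong (λ z → fold b (z % b)) (sym b+s≡2r) ⟩
    fold b ((b + s) % b)     ≡⟨ cong (λ z → fold b (z % b)) (+-comm b s) ⟩
    fold b ((s + b) % b)     ≡⟨ cong (fold b) (trans ([m+n]%n≡m%n s b) (m<n⇒m%n≡m s<b)) ⟩
    fold b s                 ≡⟨ sym (fold-∸ (<⇒≤ s<b)) ⟩
    fold b (b ∸ s)           ≡⟨ cong (fold b) (sym double-fold) ⟩
    fold b (2 * (b ∸ r))     ≡⟨ cong (λ z → fold b (2 * z)) (sym (fold-> r (≰⇒> p))) ⟩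
    fold b (2 * fold b r)    ∎
    where
      open ≡-Reasoning
      s = 2 * r ∸ b
      b+s≡2r : b + s ≡ 2 * r
      b+s≡2r = m+[n∸m]≡n (<⇒≤ (≰⇒> p))
      s<b : s < b
      s<b = +-cancelˡ-< b s b (subst (_< b + b) (sym b+s≡2r)
              (subst (2 * r <_) (cong (b +_) (+-identityʳ b)) (*-monoʳ-< 2 r<b)))
      double-fold : 2 * (b ∸ r) ≡ b ∸ s
      double-fold = begin
        2 * (b ∸ r)       ≡⟨ *-distribˡ-∸ 2 b r ⟩
        2 * b ∸ 2 * r     ≡⟨ cong₂ _∸_ (cong (b +_) (+-identityʳ b)) (sym b+s≡2r) ⟩
        (b + b) ∸ (b + s) ≡⟨ [m+n]∸[m+o]≡n∸o b b s ⟩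
        b ∸ s             ∎

  mdsSeq-zero : ∀ {a} → 2 * a < b → mdsSeq b a 0 ≡ a
  mdsSeq-zero {a} a-half = begin
    fold b ((a * 1) % b) ≡⟨ cong (λ z → fold b (z % b)) (*-identityʳ a) ⟩
    fold b (a % b)       ≡⟨ cong (fold b) (m<n⇒m%n≡m (half⇒< a a-half)) ⟩
    fold b a             ≡⟨ fold-≤ a (<⇒≤ a-half) ⟩
    a                    ∎
    where open ≡-Reasoning

  mdsSeq-suc : ∀ a j → mdsSeq b a (suc j) ≡ fold b (2 * mdsSeq b a j)
  mdsSeq-suc a j = begin
    fold b ((a * (2 * 2 ^ j)) % b) ≡⟨ cong (λ z → fold b (z % b)) a*2q≡2*aq ⟩
    fold b ((2 * (a * 2 ^ j)) % b) ≡⟨ cong (fold b) (%-double (a * 2 ^ j)) ⟩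
    fold b ((2 * (a * 2 ^ j % b)) % b) ≡⟨ fold-double-residue (m%n<n (a * 2 ^ j) b) ⟩
    fold b (2 * mdsSeq b a j)       ∎
    where
      open ≡-Reasoning
      a*2q≡2*aq : a * (2 * 2 ^ j) ≡ 2 * (a * 2 ^ j)
      a*2q≡2*aq = trans (sym (*-assoc a 2 (2 ^ j))) (trans (cong (_* 2 ^ j) (*-comm a 2)) (*-assoc 2 a (2 ^ j)))

  mdsSeq-half : ∀ a j → 2 * mdsSeq b a j < b
  mdsSeq-half a j = fold-half (<⇒≤ (m%n<n (a * 2 ^ j) b))

module Orbit (b : ℕ) .{{_ : NonZero b}} (b-odd : IsOdd b) (c : ℕ → ℕ)
             (c-suc : ∀ n → c (suc n) ≡ fold b (2 * c n))
             (c-half : ∀ n → 2 * c n < b)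
             (c-zero-odd : IsOdd (c 0)) where

  open Fold b b-odd

  pullback : ∀ {i} z → 2 * z < b → c (suc i) ≡ fold b (2 * z) → c i ≡ z
  pullback {i} z z-half eq = fold-double-injective (c i) z (c-half i) z-half (trans (sym (c-suc i)) eq)

  c-suc-injective : ∀ {i j} → c (suc i) ≡ c (suc j) → c i ≡ c j
  c-suc-injective {j = j} eq = pullback (c j) (c-half j) (trans eq (c-suc j))

  periodic : ∀ {Q} → c Q ≡ c 0 → ∀ j → c (j + Q) ≡ c j
  periodic cQ zero = cQ
  periodic {Q} cQ (suc j) =
    trans (c-suc (j + Q)) (trans (cong (λ z → fold b (2 * z)) (periodic cQ j)) (sym (c-suc j)))

  module Descent {x k y : ℕ} (x-half : 2 * x < b) (factor : 2 ^ suc k * y ≡ b ∸ x) where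

    double-power : ∀ e → 2 * (2 ^ e * y) ≡ 2 ^ suc e * y
    double-power e = sym (*-assoc 2 (2 ^ e) y)

    power-≤ : ∀ e → e ≤ k → 2 * (2 ^ e * y) ≤ b ∸ x
    power-≤ e e≤k = begin
      2 * (2 ^ e * y)   ≡⟨ double-power e ⟩
      2 ^ suc e * y     ≤⟨ *-monoˡ-≤ y (^-monoʳ-≤ 2 (s≤s e≤k)) ⟩
      2 ^ suc k * y     ≡⟨ factor ⟩
      b ∸ x             ∎
      where open ≤-Reasoning

    power-half : ∀ e → e ≤ k → 2 * (2 ^ e * y) < b
    power-half e e≤k = double-≤⇒< (2 ^ e * y) (≤-trans (power-≤ e e≤k) (m∸n≤m b x))

    fold-double-below : ∀ e → e < k → fold b (2 * (2 ^ e * y)) ≡ 2 ^ suc e * y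
    fold-double-below e e<k = trans (fold-≤ (2 * (2 ^ e * y)) below) (double-power e)
      where
        below : 2 * (2 * (2 ^ e * y)) ≤ b
        below = ≤-trans (≤-reflexive (cong (2 *_) (double-power e)))
                  (≤-trans (power-≤ (suc e) e<k) (m∸n≤m b x))

    fold-double-top : fold b (2 * (2 ^ k * y)) ≡ x
    fold-double-top = begin
      fold b (2 * (2 ^ k * y)) ≡⟨ cong (fold b) (trans (double-power k) factor) ⟩
      fold b (b ∸ x)           ≡⟨ fold-∸ (<⇒≤ (half⇒< x x-half)) ⟩
      fold b x                 ≡⟨ fold-≤ x (<⇒≤ x-half) ⟩
      x                        ∎
      where open ≡-Reasoning

    -- The walk cannot reach position 0 early: there c is odd, while 2^(e+1) y is even.
    walk : ∀ {j} → 0 < j → c j ≡ x → ∀ d e → d + e ≡ k →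
      Σ ℕ λ i → i + suc d ≡ j × c i ≡ 2 ^ e * y
    walk {suc j} _ cj zero e refl =
      j , +-comm j 1 , pullback (2 ^ e * y) (power-half e ≤-refl) (trans cj (sym fold-double-top))
    walk j>0 cj (suc d) e d+e≡k with walk j>0 cj d (suc e) (trans (+-suc d e) d+e≡k)
    ... | zero , _ , c0 =
        contradiction (subst IsOdd (trans c0 (sym (double-power e))) c-zero-odd) (¬odd-double (2 ^ e * y))
    ... | suc i , i+d≡j , ci = i , trans (+-suc i (suc d)) i+d≡j ,
        pullback (2 ^ e * y) (power-half e (<⇒≤ e<k)) (trans ci (sym (fold-double-below e e<k)))
      where
        e<k : e < k
        e<k = subst (suc e ≤_) d+e≡k (s≤s (m≤n+m e d))

    ascend : ∀ {i} → c i ≡ y → ∀ e → e ≤ k → c (i + e) ≡ 2 ^ e * y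
    ascend {i} ci zero _ = trans (cong c (+-identityʳ i)) (trans ci (sym (*-identityˡ y)))
    ascend {i} ci (suc e) e<k = begin
      c (i + suc e)            ≡⟨ cong c (+-suc i e) ⟩
      c (suc (i + e))          ≡⟨ c-suc (i + e) ⟩
      fold b (2 * c (i + e))   ≡⟨ cong (λ z → fold b (2 * z)) (ascend ci e (<⇒≤ e<k)) ⟩
      fold b (2 * (2 ^ e * y)) ≡⟨ fold-double-below e e<k ⟩
      2 ^ suc e * y            ∎
      where open ≡-Reasoning

    even-between : ∀ {i} → c i ≡ y → ∀ m → i < m → m < i + suc k → ¬ IsOdd (c m)
    even-between {i} ci m i<m m<top with m≤n⇒∃[o]m+o≡n i<m
    ... | o , refl = subst (λ z → ¬ IsOdd z) (sym c-even) (¬odd-double (2 ^ o * y))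
      where
        o<k : suc o ≤ k
        o<k = ≤-pred (+-cancelˡ-< i (suc o) (suc k) (subst (_< i + suc k) (sym (+-suc i o)) m<top))
        c-even : c (suc (i + o)) ≡ 2 * (2 ^ o * y)
        c-even = trans (cong c (sym (+-suc i o))) (trans (ascend ci (suc o) o<k) (sym (double-power o)))

  back-step : ∀ {j x K y} → 0 < j → 2 * x < b → 0 < K → 2 ^ K * y ≡ b ∸ x → c j ≡ x →
    Σ ℕ λ i → i + K ≡ j × c i ≡ y × (∀ m → i < m → m < j → ¬ IsOdd (c m))
  back-step {j} {x} {suc k} {y} j>0 x-half _ factor cj =
    let i , i+K≡j , ci = walk j>0 cj k 0 (+-identityʳ k)
        ci-y = trans ci (*-identityˡ y)
    in i , i+K≡j , ci-y , λ m i<m m<j → even-between ci-y m i<m (subst (m <_) (sym i+K≡j) m<j)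
    where open Descent {x} {k} {y} x-half factor

module _ {P : Pred ℕ 0ℓ} (P? : Decidable P) where

  filter-reverse : ∀ xs → filter P? (reverse xs) ≡ reverse (filter P? xs)
  filter-reverse [] = refl
  filter-reverse (x ∷ xs) with P? x
  ... | yes px = begin
    filter P? (reverse (x ∷ xs))             ≡⟨ cong (filter P?) (unfold-reverse x xs) ⟩
    filter P? (reverse xs ∷ʳ x)              ≡⟨ filter-++ P? (reverse xs) (x ∷ []) ⟩
    filter P? (reverse xs) ++ filter P? (x ∷ []) ≡⟨ cong₂ _++_ (filter-reverse xs) (filter-accept P? px) ⟩
    reverse (filter P? xs) ∷ʳ x              ≡⟨ sym (unfold-reverse x (filter P? xs)) ⟩
    reverse (x ∷ filter P? xs)               ∎
    where open ≡-Reasoning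
  ... | no ¬px = begin
    filter P? (reverse (x ∷ xs))             ≡⟨ cong (filter P?) (unfold-reverse x xs) ⟩
    filter P? (reverse xs ∷ʳ x)              ≡⟨ filter-++ P? (reverse xs) (x ∷ []) ⟩
    filter P? (reverse xs) ++ filter P? (x ∷ []) ≡⟨ cong₂ _++_ (filter-reverse xs) (filter-reject P? ¬px) ⟩
    reverse (filter P? xs) ++ []             ≡⟨ ++-identityʳ _ ⟩
    reverse (filter P? xs)                   ∎
    where open ≡-Reasoning

  filter-downFrom-gap : ∀ {m l} → m ≤ l → (∀ i → m < i → i ≤ l → ¬ P i) →
    filter P? (applyDownFrom suc l) ≡ filter P? (applyDownFrom suc m)
  filter-downFrom-gap {m} {zero} z≤n _ = refl
  filter-downFrom-gap {m} {suc l} m≤l gap with m≤n⇒m<n∨m≡n m≤l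
  ... | inj₂ refl = refl
  ... | inj₁ m<l = trans (filter-reject P? (gap (suc l) m<l ≤-refl))
                     (filter-downFrom-gap (≤-pred m<l) (λ i m<i i≤l → gap i m<i (m≤n⇒m≤1+n i≤l)))

  filter-downFrom-chain : ∀ (p : ℕ → ℕ) n → p n ≡ 0 →
    (∀ t → t < n → p (suc t) < p t × P (p t) × (∀ i → p (suc t) < i → i < p t → ¬ P i)) →
    filter P? (applyDownFrom suc (p 0)) ≡ applyUpTo p n
  filter-downFrom-chain p zero p0≡0 _ = cong (filter P? ∘′ applyDownFrom suc) p0≡0
  filter-downFrom-chain p (suc n) pn≡0 chain with p 0 | chain 0 z<s
  ... | suc l | p1<p0 , Pp0 , gap = begin
    filter P? (applyDownFrom suc (suc l))       ≡⟨ filter-accept P? Pp0 ⟩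
    suc l ∷ filter P? (applyDownFrom suc l)     ≡⟨ cong (suc l ∷_) (filter-downFrom-gap (≤-pred p1<p0) gap′) ⟩
    suc l ∷ filter P? (applyDownFrom suc (p 1)) ≡⟨ cong (suc l ∷_) (filter-downFrom-chain (p ∘′ suc) n pn≡0 chain′) ⟩
    suc l ∷ applyUpTo (p ∘′ suc) n              ∎
    where
      open ≡-Reasoning
      gap′ : ∀ i → p 1 < i → i ≤ l → ¬ P i
      gap′ i p1<i i≤l = gap i p1<i (s≤s i≤l)
      chain′ : ∀ t → t < n → p (suc (suc t)) < p (suc t) × P (p (suc t)) ×
        (∀ i → p (suc (suc t)) < i → i < p (suc t) → ¬ P i)
      chain′ t t<n = chain (suc t) (s≤s t<n)

diffs-chain : ∀ (p k : ℕ → ℕ) n → p n ≡ 0 → (∀ t → t < n → p t ≡ k t + p (suc t)) →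
  diffs (applyUpTo p n) ≡ applyUpTo k n
diffs-chain p k zero _ _ = refl
diffs-chain p k (suc zero) p1≡0 step =
  cong (_∷ []) (trans (step 0 z<s) (trans (cong (k 0 +_) p1≡0) (+-identityʳ (k 0))))
diffs-chain p k (suc (suc n)) pn≡0 step =
  cong₂ _∷_ (trans (cong (_∸ p 1) (step 0 z<s)) (m+n∸n≡m (k 0) (p 1)))
            (diffs-chain (p ∘′ suc) (k ∘′ suc) (suc n) pn≡0 (λ t t<n → step (suc t) (s≤s t<n)))

applyUpTo-cong : ∀ {A : Set} {f g : ℕ → A} n → (∀ t → t < n → f t ≡ g t) →
  applyUpTo f n ≡ applyUpTo g n
applyUpTo-cong zero _ = refl
applyUpTo-cong (suc n) eq = cong₂ _∷_ (eq 0 z<s) (applyUpTo-cong n (λ t t<n → eq (suc t) (s≤s t<n)))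

decreasing⇒first-zero : (f : ℕ → ℕ) → (∀ t → 0 < f t → f (suc t) < f t) →
  Σ ℕ λ r → f r ≡ 0 × (∀ s → s < r → 0 < f s)
decreasing⇒first-zero f decreasing = below (f 0) f decreasing ≤-refl
  where
    below : ∀ n (f : ℕ → ℕ) → (∀ t → 0 < f t → f (suc t) < f t) → f 0 ≤ n →
      Σ ℕ λ r → f r ≡ 0 × (∀ s → s < r → 0 < f s)
    below n f decreasing f0≤n with f 0 ≟ 0
    ... | yes f0≡0 = 0 , f0≡0 , λ _ ()
    below zero f decreasing f0≤n | no f0≢0 = contradiction (n≤0⇒n≡0 f0≤n) f0≢0
    below (suc n) f decreasing f0≤n | no f0≢0 =
      let f0>0 = n≢0⇒n>0 f0≢0
          f1≤n = ≤-pred (≤-trans (decreasing 0 f0>0) f0≤n)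
          r , fr≡0 , positive = below n (f ∘′ suc) (λ t → decreasing (suc t)) f1≤n
      in suc r , fr≡0 , λ { zero _ → f0>0 ; (suc s) s<r → positive s (≤-pred s<r) }

module Coach (b : ℕ) (b-odd : IsOdd b) (a : ℕ) (a-odd : IsOdd a) (a-half : 2 * a < b) where

  A K : ℕ → ℕ
  A = coachA b a
  K = coachK b a

  private
    gap>0 : ∀ t → 2 * A t < b → 0 < b ∸ A t
    gap>0 t half = m<n⇒0<n∸m (half⇒< (A t) half)

  K-pos-of : ∀ t → IsOdd (A t) → 2 * A t < b → 0 < K t
  K-pos-of t odd half = val2-pos (b ∸ A t) (gap>0 t half) (odd∸odd-even b-odd odd (<⇒≤ (half⇒< (A t) half)))

  coach-odd-half : ∀ t → IsOdd (A t) × 2 * A t < b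
  coach-odd-half zero = a-odd , a-half
  coach-odd-half (suc t) =
    let odd , half = coach-odd-half t
        factor , A′-odd = oddPart-spec (b ∸ A t) (gap>0 t half)
        2A′≤ : 2 * A (suc t) ≤ b ∸ A t
        2A′≤ = ≤-trans (*-monoˡ-≤ (A (suc t)) (^-monoʳ-≤ 2 (K-pos-of t odd half))) (≤-reflexive factor)
    in A′-odd , ≤-<-trans 2A′≤ (∸-monoʳ-< (odd⇒>0 odd) (<⇒≤ (half⇒< (A t) half)))

  K-pos : ∀ t → 0 < K t
  K-pos t = K-pos-of t (proj₁ (coach-odd-half t)) (proj₂ (coach-odd-half t))

  coach-factor : ∀ t → 2 ^ K t * A (suc t) ≡ b ∸ A t
  coach-factor t = proj₁ (oddPart-spec (b ∸ A t) (gap>0 t (proj₂ (coach-odd-half t))))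

-- pos t is the position in MDS(b,i) of the coach entry a_{t+1}, counted down from pos 0 = P.
module Chain (b : ℕ) .{{_ : NonZero b}} (b-odd : IsOdd b) (a : ℕ) (a-odd : IsOdd a) (a-half : 2 * a < b)
             (P : ℕ) (P-primitive : IsPrimitivePeriod (mdsSeq b a) P) where

  open Fold b b-odd
  open Coach b b-odd a a-odd a-half

  c : ℕ → ℕ
  c = mdsSeq b a

  c-zero : c 0 ≡ a
  c-zero = mdsSeq-zero a-half

  open Orbit b b-odd c (mdsSeq-suc a) (mdsSeq-half a) (subst IsOdd (sym c-zero) a-odd)

  pos : ℕ → ℕ
  pos zero = P
  pos (suc t) = pos t ∸ K t

  pos-decreasing : ∀ t → 0 < pos t → pos (suc t) < pos t
  pos-decreasing t pt>0 with pos t | K t | K-pos t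
  ... | suc p | suc k | _ = s≤s (m∸n≤m p k)

  first-zero : Σ ℕ λ r → pos r ≡ 0 × (∀ s → s < r → 0 < pos s)
  first-zero = decreasing⇒first-zero pos pos-decreasing

  r : ℕ
  r = proj₁ first-zero

  pos-r : pos r ≡ 0
  pos-r = proj₁ (proj₂ first-zero)

  pos-positive : ∀ t → t < r → 0 < pos t
  pos-positive = proj₂ (proj₂ first-zero)

  r-pos : 0 < r
  r-pos = n≢0⇒n>0 λ r≡0 → <⇒≢ (proj₁ P-primitive) (sym (subst (λ s → pos s ≡ 0) r≡0 pos-r))

  c-P : c P ≡ a
  c-P = trans (c-suc-injective {P} {0} (proj₁ (proj₂ P-primitive) 1 ≤-refl)) c-zero

  chain-step : ∀ t → 0 < pos t → c (pos t) ≡ A t →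
    pos t ≡ K t + pos (suc t) × c (pos (suc t)) ≡ A (suc t) ×
    (∀ m → pos (suc t) < m → m < pos t → ¬ IsOdd (c m))
  chain-step t pt>0 cpt =
    let half = proj₂ (coach-odd-half t)
        i , i+K≡pt , ci , gap = back-step pt>0 half (K-pos t) (coach-factor t) cpt
        pos′≡i : pos (suc t) ≡ i
        pos′≡i = trans (cong (_∸ K t) (sym i+K≡pt)) (m+n∸n≡m i (K t))
    in trans (sym i+K≡pt) (trans (+-comm i (K t)) (cong (K t +_) (sym pos′≡i))) ,
       trans (cong c pos′≡i) ci ,
       (λ m lt → gap m (subst (_< m) pos′≡i lt))

  c-pos : ∀ t → t ≤ r → c (pos t) ≡ A t
  c-pos zero _ = c-P
  c-pos (suc t) t<r = proj₁ (proj₂ (chain-step t (pos-positive t t<r) (c-pos t (<⇒≤ t<r))))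

  pos-below-P : ∀ t → t < r → pos (suc t) < P
  pos-below-P zero _ = pos-decreasing 0 (pos-positive 0 r-pos)
  pos-below-P (suc t) t<r =
    <-trans (pos-decreasing (suc t) (pos-positive (suc t) t<r)) (pos-below-P t (<-trans (n<1+n t) t<r))

  coach-length : IsCoachLength b a r
  coach-length = r-pos , trans (sym (c-pos r ≤-refl)) (trans (cong c pos-r) c-zero) , no-earlier-return
    where
      -- An earlier return of the coach to a would make pos s < P a period of c.
      no-earlier-return : ∀ s → 1 ≤ s → s < r → A s ≢ a
      no-earlier-return (suc s) _ s<r As≡a =
        proj₂ (proj₂ P-primitive) (pos (suc s)) (pos-positive (suc s) s<r) (pos-below-P s (<-trans (n<1+n s) s<r))
          (λ j _ → periodic (trans (c-pos (suc s) (<⇒≤ s<r)) (trans As≡a (sym c-zero))) j)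

  odd? : Decidable (λ j → IsOdd (c j))
  odd? j = c j % 2 ≟ 1

  odd-positions : reverse (oddPositions c P) ≡ applyUpTo pos r
  odd-positions = begin
    reverse (filter odd? (map suc (upTo P)))   ≡⟨ sym (filter-reverse odd? (map suc (upTo P))) ⟩
    filter odd? (reverse (map suc (upTo P)))   ≡⟨ cong (filter odd? ∘′ reverse) (map-upTo suc P) ⟩
    filter odd? (reverse (applyUpTo suc P))    ≡⟨ cong (filter odd?) (reverse-applyUpTo suc P) ⟩
    filter odd? (applyDownFrom suc P)          ≡⟨ filter-downFrom-chain odd? pos r pos-r link ⟩
    applyUpTo pos r                            ∎
    where
      open ≡-Reasoning
      link : ∀ t → t < r → pos (suc t) < pos t × IsOdd (c (pos t)) ×
        (∀ m → pos (suc t) < m → m < pos t → ¬ IsOdd (c m))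
      link t t<r = pos-decreasing t (pos-positive t t<r) ,
        subst IsOdd (sym (c-pos t (<⇒≤ t<r))) (proj₁ (coach-odd-half t)) ,
        proj₂ (proj₂ (chain-step t (pos-positive t t<r) (c-pos t (<⇒≤ t<r))))

  Urow≡Arow : Urow c P ≡ Arow b a r
  Urow≡Arow = begin
    reverse (map c (oddPositions c P)) ≡⟨ sym (reverse-map c (oddPositions c P)) ⟩
    map c (reverse (oddPositions c P)) ≡⟨ cong (map c) odd-positions ⟩
    map c (applyUpTo pos r)            ≡⟨ map-applyUpTo pos c r ⟩
    applyUpTo (c ∘′ pos) r             ≡⟨ applyUpTo-cong r (λ t t<r → c-pos t (<⇒≤ t<r)) ⟩
    applyUpTo A r                      ≡⟨ sym (map-upTo A r) ⟩
    map A (upTo r)                     ∎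
    where open ≡-Reasoning

  Lrow≡Krow : Lrow c P ≡ Krow b a r
  Lrow≡Krow = begin
    diffs (reverse (oddPositions c P)) ≡⟨ cong diffs odd-positions ⟩
    diffs (applyUpTo pos r)            ≡⟨ diffs-chain pos K r pos-r step ⟩
    applyUpTo K r                      ≡⟨ sym (map-upTo K r) ⟩
    map K (upTo r)                     ∎
    where
      open ≡-Reasoning
      step : ∀ t → t < r → pos t ≡ K t + pos (suc t)
      step t t<r = proj₁ (chain-step t (pos-positive t t<r) (c-pos t (<⇒≤ t<r)))

mdsInput-odd-half : ∀ {b} .{{_ : NonZero b}} → 3 ≤ b → ∀ {a prev} → MDSInputs b (a ∷ prev) →
  IsOdd a × 2 * a < b
mdsInput-odd-half b≥3 first = refl , b≥3
mdsInput-odd-half _ (next _ (a-odd , (_ , a-half , _) , _)) = a-odd , a-half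

proposition28 : (b : ℕ) → .{{_ : NonZero b}} → 3 ≤ b → IsOdd b →
    (a : ℕ) (prev : List ℕ) → MDSInputs b (a ∷ prev) →
    (P : ℕ) → IsPrimitivePeriod (mdsSeq b a) P →
    Σ ℕ (λ r → IsCoachLength b a r ×
      Urow (mdsSeq b a) P ≡ Arow b a r × Lrow (mdsSeq b a) P ≡ Krow b a r)
proposition28 b b≥3 b-odd a prev inputs P P-primitive = r , coach-length , Urow≡Arow , Lrow≡Krow
  where
    a-odd-half = mdsInput-odd-half b≥3 inputs
    open Chain b b-odd a (proj₁ a-odd-half) (proj₂ a-odd-half) P P-primitive
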